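{- Let $G$ be a convex bipartite graph satisfying Property B. If $X_{p..q}$ and $X_{p'..q'}$ are both maximal with $1<p<q<n$, $1<p'<q'<n$, $p<p'$ and $q<q'$, then $p<q<p'<q'$.
   Context: All graphs are finite, simple, connected and unweighted. A convex bipartite graph is a bipartite graph $G$ with bipartition $(X,Y)$ together with an ordering $X=(x_1,\ldots,x_n)$ such that for every $y\in Y$ the neighborhood $N_G(y)$ consists of consecutive vertices of this ordering; $n=|X|$. For $1\le p<q\le n$ let $X_{p..q}=\{x_p,\ldots,x_q\}$, $N_G[X_{p..q}]=\{y\in Y : N_G(y)\subseteq X_{p..q}\}$ and $N'_G[X_{p..q}]=\{y\in Y : |N_G(y)\cap X_{p..q}|\ge 2\}$. A vertex is pendant if it has degree $1$. $G$ satisfies Property B if: (1) for all $1\le p<q\le n$ with $(p,q)\ne(1,n)$, $|N_G[X_{p..q}]|\le q-p+1$, and $|N_G[X_{1..n}]|\le n+1$; (2) for every integer $j\in\{1,\ldots,n-1\}$ and all indices with $1\le p_1<q_1\le p_2<q_2\le\cdots\le p_j<q_j\le n$, $\left|\bigcup_{i=1}^j N'_G[X_{p_i..q_i}]\right|\ge\sum_{i=1}^j (q_i-p_i)$; (3) $G$ has at most $2$ pendant vertices, and if $n\ge 2$ no $x\in X$ is adjacent to two pendant vertices of $Y$. A set $X_{p..q}$ ($1\le p<q\le n$) is maximal if $|N_G[X_{p..q}]|=q-p+1$ and there is no $X_{p'..q'}$ with $|N_G[X_{p'..q'}]|=q'-p'+1$ and either $1<p'<p<q\le q'<n$ or $1<p'\le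 p<q<q'<n$. -}

module Defs where

import Level
open import Data.Nat using (ℕ; zero; suc; _+_; _∸_; _≤_; _<_; _≤?_)
open import Data.Fin using (Fin; toℕ)
open import Data.Fin.Properties using (all?)
open import Data.Bool using (Bool; true; false)
import Data.Bool as B
open import Data.List using (List; []; _∷_; length; filter)
open import Data.List.Base using (allFin)
open import Data.List.Relation.Unary.Any using (Any; any?)
open import Data.Product using (_×_; _,_; Σ; ∃; ∃-syntax)
open import Data.Sum using (_⊎_; inj₁; inj₂)
open import Data.Empty using (⊥)
open import Data.Unit using (⊤)
open import Relation.Nullary using (¬_; Dec)
open import Relation.Nullary.Decidable using (_×-dec_; _→-dec_)
open import Relation.Unary using (Pred; Decidable)
open import Relation.Binary.PropositionalEquality using (_≡_; _≢_)
open import Relation.Binary.Construct.Closure.ReflexiveTransitive using (Star)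

count : ∀ {k} {P : Pred (Fin k) Level.zero} → Decidable P → ℕ
count {k} d = length (filter d (allFin k))

-- Convex bipartite graph: X = {x_1,…,x_n} (x_i is the element of Fin n with
-- toℕ = i - 1), Y = Fin m, adjacency given by a Boolean matrix (so the graph
-- is simple and bipartite), neighbourhoods of Y-vertices are consecutive in
-- the ordering of X, and the graph is connected.
data Vertex (n m : ℕ) : Set where
  xv : Fin n → Vertex n m
  yv : Fin m → Vertex n m

data Edge {n m : ℕ} (adj : Fin n → Fin m → Bool) : Vertex n m → Vertex n m → Set where
  xy : ∀ x y → adj x y ≡ true → Edge adj (xv x) (yv y)
  yx : ∀ x y → adj x y ≡ true → Edge adj (yv y) (xv x)

record ConvexBipartite : Set where
  field
    n   : ℕ
    m   : ℕ
    adj : Fin n → Fin m → Bool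
    convex    : ∀ (y : Fin m) (i j k : Fin n) → toℕ i ≤ toℕ j → toℕ j ≤ toℕ k →
                adj i y ≡ true → adj k y ≡ true → adj j y ≡ true
    connected : ∀ (u v : Vertex n m) → Star (Edge adj) u v

module Notions (G : ConvexBipartite) where
  open ConvexBipartite G

  pos : Fin n → ℕ
  pos x = suc (toℕ x)

  InX : ℕ → ℕ → Fin n → Set
  InX p q x = p ≤ pos x × pos x ≤ q

  inX? : ∀ p q → Decidable (InX p q)
  inX? p q x = (p ≤? pos x) ×-dec (pos x ≤? q)

  Adj : Fin n → Fin m → Set
  Adj x y = adj x y ≡ true

  InNcl : ℕ → ℕ → Fin m → Set
  InNcl p q y = ∀ x → Adj x y → InX p q x

  inNcl? : ∀ p q → Decidable (InNcl p q)
  inNcl? p q y = all? (λ x → (adj x y B.≟ true) →-dec inX? p q x)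

  Ncl : ℕ → ℕ → ℕ
  Ncl p q = count (inNcl? p q)

  degIn : ℕ → ℕ → Fin m → ℕ
  degIn p q y = count (λ x → (adj x y B.≟ true) ×-dec inX? p q x)

  InN' : ℕ → ℕ → Fin m → Set
  InN' p q y = 2 ≤ degIn p q y

  InUnionN' : List (ℕ × ℕ) → Fin m → Set
  InUnionN' ivs y = Any (λ { (p , q) → InN' p q y }) ivs

  inUnionN'? : ∀ ivs → Decidable (InUnionN' ivs)
  inUnionN'? ivs y = any? (λ { (p , q) → 2 ≤? degIn p q y }) ivs

  ChainFrom : ℕ → List (ℕ × ℕ) → Set
  ChainFrom lo []              = ⊤
  ChainFrom lo ((p , q) ∷ ivs) = lo ≤ p × p < q × q ≤ n × ChainFrom q ivs

  Chain : List (ℕ × ℕ) → Set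
  Chain ivs = ChainFrom 1 ivs

  lenSum : List (ℕ × ℕ) → ℕ
  lenSum []              = 0
  lenSum ((p , q) ∷ ivs) = (q ∸ p) + lenSum ivs

  degX : Fin n → ℕ
  degX x = count (λ y → adj x y B.≟ true)

  degY : Fin m → ℕ
  degY y = count (λ x → adj x y B.≟ true)

  numPendant : ℕ
  numPendant = count (λ x → degX x Data.Nat.≟ 1) + count (λ y → degY y Data.Nat.≟ 1)
    where import Data.Nat

  record PropertyB : Set where
    field
      cond1     : ∀ p q → 1 ≤ p → p < q → q ≤ n → ¬ (p ≡ 1 × q ≡ n) →
                  Ncl p q ≤ (q ∸ p) + 1
      cond1full : Ncl 1 n ≤ n + 1
      cond2     : ∀ (ivs : List (ℕ × ℕ)) → 1 ≤ length ivs → length ivs ≤ n ∸ 1 →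
                  Chain ivs → lenSum ivs ≤ count (inUnionN'? ivs)
      cond3a    : numPendant ≤ 2
      cond3b    : 2 ≤ n → ∀ (x : Fin n) (y y' : Fin m) → y ≢ y' →
                  Adj x y → Adj x y' → degY y ≡ 1 → degY y' ≡ 1 → ⊥

  Tight : ℕ → ℕ → Set
  Tight p q = 1 ≤ p × p < q × q ≤ n × Ncl p q ≡ (q ∸ p) + 1

  Maximal : ℕ → ℕ → Set
  Maximal p q = Tight p q ×
    ¬ (∃[ p' ] ∃[ q' ] (Tight p' q' ×
         ((1 < p' × p' < p × p < q × q ≤ q' × q' < n)
          ⊎ (1 < p' × p' ≤ p × p < q × q < q' × q' < n))))

module Submission where

-- Write size a b = b - a + 1 and N[a..b] = |N_G[X_{a..b}]|.  The map
-- (a , b) ↦ N[a..b] is supermodular on crossing intervals: for p ≤ p' and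
-- q ≤ q' every y counted in N[p..q] or N[p'..q'] is counted in N[p..q'], and
-- every y counted in both is counted in N[p'..q].  Property B bounds
-- N[a..b] ≤ size a b for every proper interval: for a < b this is
-- condition (1), and for a = b the vertices y with N(y) = {x_a} are pendant
-- vertices sharing the neighbour x_a, so condition (3) leaves at most one.
-- Hence if X_{p..q} and X_{p'..q'} are tight and overlap (p' ≤ q), then
--   size p q + size p' q' ≤ N[p..q'] + N[p'..q] ≤ N[p..q'] + size p' q,
-- and size p q + size p' q' = size p q' + size p' q, so X_{p..q'} is tight.
-- With p' > p and q' > q this tight interval contradicts the maximality of
-- X_{p..q}.

open import Defs
open import Data.Nat using (ℕ; _<_; _≤_; _+_; _∸_; suc; z≤n; s≤s; _<?_)
open import Data.Nat.Properties
open import Data.Product using (_×_; _,_; proj₁; proj₂; ∃)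
open import Data.Sum using (inj₁; inj₂)
open import Data.Empty using (⊥-elim)
open import Data.Bool using (true)
import Data.Bool as B
open import Data.Fin using (Fin; fromℕ<) renaming (_≟_ to _≟ᶠ_)
open import Data.Fin.Properties using (toℕ-injective)
open import Data.List using (List; []; _∷_; length; filter)
open import Data.List.Base using (allFin)
open import Data.List.Relation.Unary.All using (_∷_)
open import Data.List.Relation.Unary.AllPairs using (_∷_)
open import Data.List.Relation.Unary.Any using (here; there)
open import Data.List.Relation.Unary.Unique.Propositional using (Unique)
open import Data.List.Relation.Unary.Unique.Propositional.Properties using (allFin⁺; filter⁺)
open import Data.List.Membership.Propositional using (_∈_)
open import Data.List.Membership.Propositional.Properties using (∈-filter⁺; ∈-filter⁻; ∈-allFin)
open import Relation.Nullary using (Dec; yes; no; ¬_)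
open import Relation.Unary using (Pred; Decidable)
open import Relation.Binary.PropositionalEquality using (_≡_; refl; sym; trans; cong; cong₂; subst; module ≡-Reasoning)
open import Relation.Binary.Construct.Closure.ReflexiveTransitive using (_◅_)
open import Algebra.Properties.CommutativeSemigroup +-commutativeSemigroup using (interchange)
import Level

module Counting {A : Set} where

  𝟙 : {P : Set} → Dec P → ℕ
  𝟙 (yes _) = 1
  𝟙 (no _)  = 0

  length-filter-∷ : {P : Pred A Level.zero} (d : Decidable P) (x : A) (l : List A) →
                    length (filter d (x ∷ l)) ≡ 𝟙 (d x) + length (filter d l)
  length-filter-∷ d x l with d x
  ... | yes _ = refl
  ... | no _  = refl

  indicator-cross : {P Q R S : Set} → (P → R) → (Q → R) → (P → Q → S) →
                    (a : Dec P) (b : Dec Q) (c : Dec R) (d : Dec S) →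
                    𝟙 a + 𝟙 b ≤ 𝟙 c + 𝟙 d
  indicator-cross P⇒R Q⇒R P∧Q⇒S (yes _) (yes _) (yes _) (yes _)  = ≤-refl
  indicator-cross P⇒R Q⇒R P∧Q⇒S (yes p) (yes q) (yes _) (no ¬s)  = ⊥-elim (¬s (P∧Q⇒S p q))
  indicator-cross P⇒R Q⇒R P∧Q⇒S (yes p) _       (no ¬r) _        = ⊥-elim (¬r (P⇒R p))
  indicator-cross P⇒R Q⇒R P∧Q⇒S (no _)  (yes q) (no ¬r) _        = ⊥-elim (¬r (Q⇒R q))
  indicator-cross P⇒R Q⇒R P∧Q⇒S (yes _) (no _)  (yes _) _        = s≤s z≤n
  indicator-cross P⇒R Q⇒R P∧Q⇒S (no _)  (yes _) (yes _) _        = s≤s z≤n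
  indicator-cross P⇒R Q⇒R P∧Q⇒S (no _)  (no _)  _       _        = z≤n

  count-cross : {P Q R S : Pred A Level.zero}
                (a : Decidable P) (b : Decidable Q) (c : Decidable R) (d : Decidable S) →
                (∀ x → P x → R x) → (∀ x → Q x → R x) → (∀ x → P x → Q x → S x) →
                ∀ l → length (filter a l) + length (filter b l) ≤ length (filter c l) + length (filter d l)
  count-cross a b c d P⇒R Q⇒R P∧Q⇒S [] = z≤n
  count-cross a b c d P⇒R Q⇒R P∧Q⇒S (x ∷ l) = begin
      length (filter a (x ∷ l)) + length (filter b (x ∷ l))
    ≡⟨ cong₂ _+_ (length-filter-∷ a x l) (length-filter-∷ b x l) ⟩
      (𝟙 (a x) + length (filter a l)) + (𝟙 (b x) + length (filter b l))
    ≡⟨ interchange (𝟙 (a x)) _ (𝟙 (b x)) _ ⟩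
      (𝟙 (a x) + 𝟙 (b x)) + (length (filter a l) + length (filter b l))
    ≤⟨ +-mono-≤ (indicator-cross (P⇒R x) (Q⇒R x) (P∧Q⇒S x) (a x) (b x) (c x) (d x))
                (count-cross a b c d P⇒R Q⇒R P∧Q⇒S l) ⟩
      (𝟙 (c x) + 𝟙 (d x)) + (length (filter c l) + length (filter d l))
    ≡⟨ interchange (𝟙 (c x)) (𝟙 (d x)) _ _ ⟩
      (𝟙 (c x) + length (filter c l)) + (𝟙 (d x) + length (filter d l))
    ≡⟨ sym (cong₂ _+_ (length-filter-∷ c x l) (length-filter-∷ d x l)) ⟩
      length (filter c (x ∷ l)) + length (filter d (x ∷ l))
    ∎
    where open ≤-Reasoning

  unique-constant-length≤1 : (l : List A) → Unique l → (∀ a b → a ∈ l → b ∈ l → a ≡ b) → length l ≤ 1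
  unique-constant-length≤1 []              _                _  = z≤n
  unique-constant-length≤1 (a ∷ [])        _                _  = s≤s z≤n
  unique-constant-length≤1 (a ∷ b ∷ l) ((a≢b ∷ _) ∷ _) same = ⊥-elim (a≢b (same a b (here refl) (there (here refl))))

count≤1 : ∀ {k} {P : Pred (Fin k) Level.zero} (d : Decidable P) →
          (∀ a b → P a → P b → a ≡ b) → count d ≤ 1
count≤1 {k} d atMostOne = Counting.unique-constant-length≤1 (filter d (allFin k)) (filter⁺ d (allFin⁺ k))
  (λ a b a∈ b∈ → atMostOne a b (proj₂ (∈-filter⁻ d {xs = allFin k} a∈)) (proj₂ (∈-filter⁻ d {xs = allFin k} b∈)))

count≥1 : ∀ {k} {P : Pred (Fin k) Level.zero} (d : Decidable P) (x : Fin k) → P x → 1 ≤ count d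
count≥1 {k} d x px with filter d (allFin k) | ∈-filter⁺ d (∈-allFin x) px
... | _ ∷ _ | _ = s≤s z≤n

size : ℕ → ℕ → ℕ
size a b = (b ∸ a) + 1

size-plus-start : ∀ {a b} → a ≤ b → size a b + a ≡ suc b
size-plus-start {a} {b} a≤b = begin
    (b ∸ a) + 1 + a   ≡⟨ +-assoc (b ∸ a) 1 a ⟩
    (b ∸ a) + suc a   ≡⟨ +-suc (b ∸ a) a ⟩
    suc ((b ∸ a) + a) ≡⟨ cong suc (m∸n+n≡m a≤b) ⟩
    suc b             ∎
  where open ≡-Reasoning

size-cross : ∀ {p q p' q'} → p ≤ p' → p' ≤ q → q ≤ q' →
             size p q + size p' q' ≡ size p q' + size p' q
size-cross {p} {q} {p'} {q'} p≤p' p'≤q q≤q' = +-cancelʳ-≡ (p + p') _ _ (begin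
    size p q + size p' q' + (p + p')     ≡⟨ interchange (size p q) _ p _ ⟩
    (size p q + p) + (size p' q' + p')   ≡⟨ cong₂ _+_ (size-plus-start p≤q) (size-plus-start p'≤q') ⟩
    suc q + suc q'                       ≡⟨ +-comm (suc q) (suc q') ⟩
    suc q' + suc q                       ≡⟨ sym (cong₂ _+_ (size-plus-start p≤q') (size-plus-start p'≤q)) ⟩
    (size p q' + p) + (size p' q + p')   ≡⟨ interchange (size p q') p (size p' q) p' ⟩
    size p q' + size p' q + (p + p')     ∎)
  where
  open ≡-Reasoning
  p≤q  = ≤-trans p≤p' p'≤q
  p≤q' = ≤-trans p≤q q≤q'
  p'≤q' = ≤-trans p'≤q q≤q'

module Intervals (G : ConvexBipartite) where
  open ConvexBipartite G
  open Notions G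

  Ncl-cross : ∀ {p q p' q'} → p ≤ p' → q ≤ q' → Ncl p q + Ncl p' q' ≤ Ncl p q' + Ncl p' q
  Ncl-cross p≤p' q≤q' = count-cross (inNcl? _ _) (inNcl? _ _) (inNcl? _ _) (inNcl? _ _)
    (λ y inPQ x x~y → proj₁ (inPQ x x~y) , ≤-trans (proj₂ (inPQ x x~y)) q≤q')
    (λ y inPQ' x x~y → ≤-trans p≤p' (proj₁ (inPQ' x x~y)) , proj₂ (inPQ' x x~y))
    (λ y inPQ inPQ' x x~y → proj₁ (inPQ' x x~y) , proj₂ (inPQ x x~y))
    (allFin m)
    where open Counting

  neighbour : Fin n → ∀ y → ∃ λ x → Adj x y
  neighbour x₀ y with connected (yv y) (xv x₀)
  ... | yx x .y x~y ◅ _ = x , x~y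

  position-of-neighbour : ∀ {a y} → InNcl a a y → ∀ x → Adj x y → pos x ≡ a
  position-of-neighbour inAA x x~y = ≤-antisym (proj₂ (inAA x x~y)) (proj₁ (inAA x x~y))

  same-position : ∀ {a} {x x' : Fin n} → pos x ≡ a → pos x' ≡ a → x ≡ x'
  same-position px px' = toℕ-injective (suc-injective (trans px (sym px')))

  singleton-pendant : Fin n → ∀ {a y} → InNcl a a y → degY y ≡ 1
  singleton-pendant x₀ {y = y} inAA = ≤-antisym
    (count≤1 (λ x → adj x y B.≟ true)
      (λ x x' x~y x'~y → same-position (position-of-neighbour inAA x x~y) (position-of-neighbour inAA x' x'~y)))
    (count≥1 (λ x → adj x y B.≟ true) (proj₁ (neighbour x₀ y)) (proj₂ (neighbour x₀ y)))

  -- Under condition (3), at most one y has N(y) ⊆ {x_a}: two such vertices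
  -- would be pendant vertices sharing their neighbour x_a.
  Ncl-singleton≤1 : PropertyB → 2 ≤ n → ∀ a → Ncl a a ≤ 1
  Ncl-singleton≤1 PB 2≤n a = count≤1 (inNcl? a a) unique
    where
    x₀ : Fin n
    x₀ = fromℕ< 2≤n
    unique : ∀ y y' → InNcl a a y → InNcl a a y' → y ≡ y'
    unique y y' inY inY' with y ≟ᶠ y'
    ... | yes y≡y' = y≡y'
    ... | no y≢y'  = ⊥-elim (PropertyB.cond3b PB 2≤n x y y' y≢y' x~y x~y'
                               (singleton-pendant x₀ inY) (singleton-pendant x₀ inY'))
      where
      x  = proj₁ (neighbour x₀ y)
      x~y = proj₂ (neighbour x₀ y)
      x~y' : Adj x y'
      x~y' = subst (λ z → Adj z y')
              (same-position (position-of-neighbour inY' _ (proj₂ (neighbour x₀ y')))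
                             (position-of-neighbour inY x x~y))
              (proj₂ (neighbour x₀ y'))

  Ncl-bound : PropertyB → 2 ≤ n → ∀ {a b} → 1 ≤ a → a ≤ b → b ≤ n → ¬ (a ≡ 1 × b ≡ n) →
              Ncl a b ≤ size a b
  Ncl-bound PB 2≤n {a} {b} 1≤a a≤b b≤n proper with m≤n⇒m<n∨m≡n a≤b
  ... | inj₁ a<b  = PropertyB.cond1 PB a b 1≤a a<b b≤n proper
  ... | inj₂ refl = subst (Ncl a a ≤_) (cong (_+ 1) (sym (n∸n≡0 a))) (Ncl-singleton≤1 PB 2≤n a)

  tight-union : PropertyB → ∀ {p q p' q'} → Tight p q → Tight p' q' →
                p ≤ p' → p' ≤ q → q ≤ q' → ¬ (p ≡ 1 × q' ≡ n) → Tight p q'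
  tight-union PB {p} {q} {p'} {q'} (1≤p , p<q , q≤n , Npq) (1≤p' , p'<q' , q'≤n , Np'q')
              p≤p' p'≤q q≤q' proper =
    1≤p , p<q' , q'≤n , ≤-antisym upper lower
    where
    p<q' = <-≤-trans p<q q≤q'
    2≤n  = ≤-trans (s≤s 1≤p) (≤-trans p<q' q'≤n)
    upper : Ncl p q' ≤ size p q'
    upper = Ncl-bound PB 2≤n 1≤p (<⇒≤ p<q') q'≤n proper
    intersection-proper : ¬ (p' ≡ 1 × q ≡ n)
    intersection-proper (refl , refl) = proper (≤-antisym p≤p' 1≤p , ≤-antisym q'≤n q≤q')
    intersection : Ncl p' q ≤ size p' q
    intersection = Ncl-bound PB 2≤n 1≤p' p'≤q (≤-trans q≤q' q'≤n) intersection-proper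
    lower : size p q' ≤ Ncl p q'
    lower = +-cancelʳ-≤ (size p' q) _ _ (begin
        size p q' + size p' q   ≡⟨ sym (size-cross p≤p' p'≤q q≤q') ⟩
        size p q + size p' q'   ≡⟨ sym (cong₂ _+_ Npq Np'q') ⟩
        Ncl p q + Ncl p' q'     ≤⟨ Ncl-cross p≤p' q≤q' ⟩
        Ncl p q' + Ncl p' q     ≤⟨ +-monoʳ-≤ (Ncl p q') intersection ⟩
        Ncl p q' + size p' q    ∎)
      where open ≤-Reasoning

lemma10 : (G : ConvexBipartite) → Notions.PropertyB G →
    ∀ (p q p' q' : ℕ) →
    Notions.Maximal G p q → Notions.Maximal G p' q' →
    1 < p → p < q → q < ConvexBipartite.n G →
    1 < p' → p' < q' → q' < ConvexBipartite.n G →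
    p < p' → q < q' →
    p < q × q < p' × p' < q'
lemma10 G PB p q p' q' (tight-pq , maximal-pq) (tight-p'q' , _)
        1<p p<q q<n 1<p' p'<q' q'<n p<p' q<q' with q <? p'
... | yes q<p' = p<q , q<p' , p'<q'
... | no q≮p'  = ⊥-elim (maximal-pq (p , q' , tight-pq' , inj₂ (1<p , ≤-refl , p<q , q<q' , q'<n)))
  where
  open Intervals G
  -- Overlapping intervals would make X_{p..q'} tight, and it strictly
  -- extends X_{p..q} to the right.
  tight-pq' = tight-union PB tight-pq tight-p'q' (<⇒≤ p<p') (≮⇒≥ q≮p') (<⇒≤ q<q')
                (λ { (p≡1 , _) → <-irrefl (sym p≡1) 1<p })
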